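{- Let $M$ be a real symmetric $n\times n$ matrix and let $A$ be an $r \times r$ submatrix of $M$. If one row of $A$ is a tropical multiple of another row of $A$ (i.e. there is $c\in\mathbb{R}$ such that one row equals the other with $c$ added to every entry), then $A$ is symmetrically tropically singular. The same holds if one column of $A$ is a tropical multiple of another column of $A$.
   Context: For a square submatrix of a symmetric real matrix $M$ with row index set $I$ and column index set $J$, each bijection $\rho: I\to J$ gives the monomial $\prod_{i\in I} X_{\{i,\rho(i)\}}$ in commuting variables indexed by unordered pairs (so $X_{i,j}=X_{j,i}$), with value $\sum_{i\in I} M_{i,\rho(i)}$. The submatrix is symmetrically tropically singular if the minimum value is attained by at least two distinct such monomials. -}

module Defs where

open import Level using (0ℓ)
open import Data.Nat using (ℕ)
open import Data.Fin using (Fin; _≤?_)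
open import Data.Fin.Permutation using (Permutation′; _⟨$⟩ʳ_)
open import Data.List using (List; map; foldr; allFin)
open import Data.List.Relation.Binary.Permutation.Propositional using (_↭_)
open import Data.Product using (_×_; _,_; Σ; ∃; ∃-syntax)
open import Data.Sum using (_⊎_)
open import Relation.Nullary using (¬_; yes; no)
open import Relation.Binary.PropositionalEquality using (_≡_; _≢_)
open import Relation.Binary.Structures using (IsTotalOrder)
open import Algebra.Structures using (IsAbelianGroup)
open import Function.Definitions using (Injective)

-- A (totally) ordered abelian group with propositional equality;
-- (ℝ, +, ≤) is an instance.  The paper works over ℝ.
record OrderedAbGroup : Set₁ where
  infixl 6 _+_
  infix 4 _≤_
  field
    Carrier        : Set
    _+_            : Carrier → Carrier → Carrier
    0#             : Carrier
    -_             : Carrier → Carrier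
    _≤_            : Carrier → Carrier → Set
    isAbelianGroup : IsAbelianGroup _≡_ _+_ 0# -_
    isTotalOrder   : IsTotalOrder _≡_ _≤_
    +-mono-≤       : ∀ {x y} z → x ≤ y → x + z ≤ y + z

module _ (G : OrderedAbGroup) where
  open OrderedAbGroup G

  sumG : List Carrier → Carrier
  sumG = foldr _+_ 0#

  Matrix : ℕ → Set
  Matrix n = Fin n → Fin n → Carrier

  Symmetric : ∀ {n} → Matrix n → Set
  Symmetric {n} M = ∀ (i j : Fin n) → M i j ≡ M j i

  record Submatrix (n r : ℕ) : Set where
    field
      rows    : Fin r → Fin n
      cols    : Fin r → Fin n
      rowsInj : Injective _≡_ _≡_ rows
      colsInj : Injective _≡_ _≡_ cols
  open Submatrix public

  entry : ∀ {n r} → Matrix n → Submatrix n r → Fin r → Fin r → Carrier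
  entry M S a b = M (rows S a) (cols S b)

  RowTropMultiple : ∀ {n r} → Matrix n → Submatrix n r → Fin r → Fin r → Set
  RowTropMultiple M S a b = ∃[ c ] (∀ k → entry M S a k ≡ c + entry M S b k)

  ColTropMultiple : ∀ {n r} → Matrix n → Submatrix n r → Fin r → Fin r → Set
  ColTropMultiple M S a b = ∃[ c ] (∀ k → entry M S k a ≡ c + entry M S k b)

  -- A bijection ρ : I → J (I = row index set, J = column index set)
  -- corresponds to a permutation σ of Fin r via ρ (rows k) = cols (σ k).

  value : ∀ {n r} → Matrix n → Submatrix n r → Permutation′ r → Carrier
  value {r = r} M S σ = sumG (map (λ k → M (rows S k) (cols S (σ ⟨$⟩ʳ k))) (allFin r))

module _ where
  upair : ∀ {n} → Fin n → Fin n → Fin n × Fin n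
  upair i j with i ≤? j
  ... | yes _ = i , j
  ... | no  _ = j , i

  -- the monomial ∏_{i ∈ I} X_{{i, ρ i}} of commuting variables, as the
  -- multiset (list up to permutation) of its unordered index pairs
  monomial : ∀ {n r} → (rows cols : Fin r → Fin n) → Permutation′ r → List (Fin n × Fin n)
  monomial {r = r} rows cols σ = map (λ k → upair (rows k) (cols (σ ⟨$⟩ʳ k))) (allFin r)

module _ (G : OrderedAbGroup) where
  open OrderedAbGroup G

  SymTropSingular : ∀ {n r} → Matrix G n → Submatrix G n r → Set
  SymTropSingular {n} {r} M S =
    Σ (Permutation′ r) λ σ → Σ (Permutation′ r) λ τ →
      ¬ (monomial (rows S) (cols S) σ ↭ monomial (rows S) (cols S) τ)
      × value G M S σ ≡ value G M S τ
      × (∀ (π : Permutation′ r) → value G M S σ ≤ value G M S π)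

{-# OPTIONS --safe #-}
-- Take a permutation σ of minimal value.  If row a is row b shifted by c, exchanging the columns
-- assigned to rows a and b changes the value by (c + M b σb) + M b σa − (c + M b σa) − M b σb = 0,
-- so the new permutation is minimal as well.  Its monomial is different: since the submatrix has
-- distinct rows and distinct columns, the variable X_{rows a, cols σa} occurs in it strictly fewer
-- times.  For columns, exchange the rows assigned to columns a and b instead.
module Submission where

open import Defs
open import Level using (0ℓ)
open import Data.Nat using (ℕ; zero; suc)
open import Data.Fin using (Fin; zero; suc; punchIn; punchOut; _≤?_)
open import Data.Fin.Properties using (_≟_)
import Data.Fin.Permutation.Components as PC
open import Data.Fin.Permutation as Perm
  using (Permutation′; _⟨$⟩ʳ_; _⟨$⟩ˡ_; _∘ₚ_; insert; remove; insert-remove)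
  renaming (_≈_ to _≈ₚ_)
open import Data.List using (List; []; _∷_; map; filter; length; tabulate; allFin)
open import Data.List.Properties using (map-tabulate; map-cong)
open import Data.List.Membership.Propositional using (_∈_)
open import Data.List.Membership.Propositional.Properties using (∈-allFin)
open import Data.List.Relation.Unary.Any using (here; there)
open import Data.List.Relation.Binary.Permutation.Propositional using (_↭_; ↭-trans; ↭-reflexive)
open import Data.List.Relation.Binary.Permutation.Propositional.Properties using (filter-↭; ↭-length)
open import Data.Product using (∃-syntax; _×_; _,_; proj₁; proj₂)
open import Data.Product.Properties using (≡-dec)
open import Data.Sum using (_⊎_; inj₁; inj₂)
open import Function using (_∘_; id)
open import Function.Bundles using (Injection)
open import Function.Definitions using (Injective)
open import Function.Properties.Inverse using (↔⇒↣)
open import Relation.Nullary using (¬_; Dec; yes; no; contradiction)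
open import Relation.Nullary.Decidable using (dec-true; dec-false)
open import Relation.Binary.Definitions using (DecidableEquality)
open import Relation.Binary.Bundles using (TotalPreorder)
open import Relation.Binary.Structures using (IsTotalOrder)
open import Relation.Binary.PropositionalEquality using (_≡_; _≢_; refl; sym; trans; cong; module ≡-Reasoning)
open import Algebra.Bundles using (CommutativeMonoid)
open import Algebra.Structures using (IsAbelianGroup)

module _ {r : ℕ} where

  transpose-matchˡ : (i j : Fin r) → PC.transpose i j i ≡ j
  transpose-matchˡ i j rewrite dec-true (i ≟ i) refl = refl

  transpose-matchʳ : (i j : Fin r) → PC.transpose i j j ≡ i
  transpose-matchʳ i j with j ≟ i
  ... | yes j≡i = j≡i
  ... | no _ rewrite dec-true (j ≟ j) refl = refl

  transpose-other : {i j k : Fin r} → k ≢ i → k ≢ j → PC.transpose i j k ≡ k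
  transpose-other {i} {j} {k} k≢i k≢j rewrite dec-false (k ≟ i) k≢i | dec-false (k ≟ j) k≢j = refl

  transpose-involutive : (i j k : Fin r) → PC.transpose i j (PC.transpose i j k) ≡ k
  transpose-involutive i j k = cases (k ≟ i) (k ≟ j)
    where
    cases : Dec (k ≡ i) → Dec (k ≡ j) → PC.transpose i j (PC.transpose i j k) ≡ k
    cases (yes refl) _ = trans (cong (PC.transpose k j) (transpose-matchˡ k j)) (transpose-matchʳ k j)
    cases (no _) (yes refl) = trans (cong (PC.transpose i k) (transpose-matchʳ i k)) (transpose-matchˡ i k)
    cases (no k≢i) (no k≢j) = trans (cong (PC.transpose i j) (transpose-other k≢i k≢j)) (transpose-other k≢i k≢j)

  transpose-conjugate : (σ : Permutation′ r) (i j : Fin r) →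
    σ ∘ₚ Perm.transpose i j ≈ₚ Perm.transpose (σ ⟨$⟩ˡ i) (σ ⟨$⟩ˡ j) ∘ₚ σ
  transpose-conjugate σ i j k = cases (k ≟ σ ⟨$⟩ˡ i) (k ≟ σ ⟨$⟩ˡ j)
    where
    open ≡-Reasoning
    i′ j′ : Fin r
    i′ = σ ⟨$⟩ˡ i
    j′ = σ ⟨$⟩ˡ j

    fromImage : ∀ {l} → σ ⟨$⟩ʳ k ≡ l → k ≡ σ ⟨$⟩ˡ l
    fromImage refl = sym (Perm.inverseˡ σ)

    cases : Dec (k ≡ i′) → Dec (k ≡ j′) → PC.transpose i j (σ ⟨$⟩ʳ k) ≡ σ ⟨$⟩ʳ PC.transpose i′ j′ k
    cases (yes refl) _ = begin
      PC.transpose i j (σ ⟨$⟩ʳ i′)  ≡⟨ cong (PC.transpose i j) (Perm.inverseʳ σ) ⟩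
      PC.transpose i j i           ≡⟨ transpose-matchˡ i j ⟩
      j                            ≡⟨ Perm.inverseʳ σ ⟨
      σ ⟨$⟩ʳ j′                     ≡⟨ cong (σ ⟨$⟩ʳ_) (transpose-matchˡ i′ j′) ⟨
      σ ⟨$⟩ʳ PC.transpose i′ j′ i′  ∎
    cases (no _) (yes refl) = begin
      PC.transpose i j (σ ⟨$⟩ʳ j′)  ≡⟨ cong (PC.transpose i j) (Perm.inverseʳ σ) ⟩
      PC.transpose i j j           ≡⟨ transpose-matchʳ i j ⟩
      i                            ≡⟨ Perm.inverseʳ σ ⟨
      σ ⟨$⟩ʳ i′                     ≡⟨ cong (σ ⟨$⟩ʳ_) (transpose-matchʳ i′ j′) ⟨
      σ ⟨$⟩ʳ PC.transpose i′ j′ j′  ∎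
    cases (no k≢i′) (no k≢j′) =
      trans (transpose-other (k≢i′ ∘ fromImage) (k≢j′ ∘ fromImage))
            (cong (σ ⟨$⟩ʳ_) (sym (transpose-other k≢i′ k≢j′)))

  collapse : Fin r → Fin r → Fin r → Fin r
  collapse i j k with k ≟ i
  ... | yes _ = j
  ... | no _ = k

  collapse-match : (i j : Fin r) → collapse i j i ≡ j
  collapse-match i j with i ≟ i
  ... | yes _ = refl
  ... | no i≢i = contradiction refl i≢i

  collapse-target : (i j : Fin r) → collapse i j j ≡ j
  collapse-target i j with j ≟ i
  ... | yes _ = refl
  ... | no _ = refl

  collapse-transpose : (i j k : Fin r) → collapse i j (PC.transpose i j k) ≡ collapse i j k
  collapse-transpose i j k = cases (k ≟ i) (k ≟ j)
    where
    cases : Dec (k ≡ i) → Dec (k ≡ j) → collapse i j (PC.transpose i j k) ≡ collapse i j k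
    cases (yes refl) _ =
      trans (cong (collapse k j) (transpose-matchˡ k j)) (trans (collapse-target k j) (sym (collapse-match k j)))
    cases (no k≢i) (yes refl) =
      trans (cong (collapse i k) (transpose-matchʳ i k)) (trans (collapse-match i k) (sym (collapse-target i k)))
    cases (no k≢i) (no k≢j) = cong (collapse i j) (transpose-other k≢i k≢j)

module PermutationSum {c ℓ} (M : CommutativeMonoid c ℓ) where
  open CommutativeMonoid M
    using (Carrier; _≈_; _∙_; ε; setoid; ∙-cong; identityˡ; reflexive) renaming (sym to ≈-sym)
  open import Algebra.Properties.CommutativeMonoid.Sum M
    using (sum; sum-cong-≋; sum-cong-≗; sum-permute; ∑-distrib-+)
  open import Relation.Binary.Reasoning.Setoid setoid

  permSum : ∀ {r} → (Fin r → Fin r → Carrier) → Permutation′ r → Carrier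
  permSum F σ = sum (λ k → F k (σ ⟨$⟩ʳ k))

  permSum-cong : ∀ {r} (F : Fin r → Fin r → Carrier) {σ τ : Permutation′ r} →
    σ ≈ₚ τ → permSum F σ ≡ permSum F τ
  permSum-cong F σ≈τ = sum-cong-≗ (λ k → cong (F k) (σ≈τ k))

  permSum-inverse : ∀ {r} (F : Fin r → Fin r → Carrier) (σ : Permutation′ r) →
    sum (λ j → F (σ ⟨$⟩ˡ j) j) ≈ permSum F σ
  permSum-inverse F σ = begin
    sum (λ j → F (σ ⟨$⟩ˡ j) j)                    ≈⟨ sum-permute _ σ ⟩
    sum (λ k → F (σ ⟨$⟩ˡ (σ ⟨$⟩ʳ k)) (σ ⟨$⟩ʳ k))  ≡⟨ sum-cong-≗ (λ k → cong (λ l → F l (σ ⟨$⟩ʳ k)) (Perm.inverseˡ σ)) ⟩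
    permSum F σ                                  ∎

  -- Row k is (c if k = a, else ε) ∙ row (collapse a b k): the transposition only permutes the constants,
  -- and collapse a b is invariant under it.
  sum-transposeRows : ∀ {r x} {X : Set x} (F : Fin r → X → Carrier) {a b : Fin r} {c : Carrier} →
    (∀ y → F a y ≈ c ∙ F b y) → (h : Fin r → X) →
    sum (λ k → F (PC.transpose a b k) (h k)) ≈ sum (λ k → F k (h k))
  sum-transposeRows {r} F {a} {b} {c} row h = begin
    sum (λ k → F (t k) (h k))                              ≈⟨ sum-cong-≋ (λ k → split (t k) (h k)) ⟩
    sum (λ k → shift (t k) ∙ F (collapse a b (t k)) (h k))  ≈⟨ ∑-distrib-+ {r} _ _ ⟩
    sum (shift ∘ t) ∙ sum (λ k → F (collapse a b (t k)) (h k))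
      ≈⟨ ∙-cong (≈-sym (sum-permute shift (Perm.transpose a b)))
                (reflexive (sum-cong-≗ (λ k → cong (λ l → F l (h k)) (collapse-transpose a b k)))) ⟩
    sum shift ∙ sum (λ k → F (collapse a b k) (h k))        ≈⟨ ∑-distrib-+ {r} _ _ ⟨
    sum (λ k → shift k ∙ F (collapse a b k) (h k))          ≈⟨ sum-cong-≋ (λ k → split k (h k)) ⟨
    sum (λ k → F k (h k))                                  ∎
    where
    t : Fin r → Fin r
    t = PC.transpose a b

    shift : Fin r → Carrier
    shift k with k ≟ a
    ... | yes _ = c
    ... | no _ = ε

    split : ∀ k y → F k y ≈ shift k ∙ F (collapse a b k) y
    split k y with k ≟ a
    ... | yes refl = row y
    ... | no _ = ≈-sym (identityˡ _)

  permSum-transposeRows : ∀ {r} (F : Fin r → Fin r → Carrier) {a b : Fin r} {c : Carrier} →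
    (∀ j → F a j ≈ c ∙ F b j) → (σ : Permutation′ r) →
    permSum F (Perm.transpose a b ∘ₚ σ) ≈ permSum F σ
  permSum-transposeRows {r} F {a} {b} row σ = begin
    sum (λ k → F k (σ ⟨$⟩ʳ t k))          ≈⟨ sum-permute _ (Perm.transpose a b) ⟩
    sum (λ k → F (t k) (σ ⟨$⟩ʳ t (t k)))  ≡⟨ sum-cong-≗ (λ k → cong (λ l → F (t k) (σ ⟨$⟩ʳ l)) (transpose-involutive a b k)) ⟩
    sum (λ k → F (t k) (σ ⟨$⟩ʳ k))        ≈⟨ sum-transposeRows F row (σ ⟨$⟩ʳ_) ⟩
    permSum F σ                          ∎
    where
    t : Fin r → Fin r
    t = PC.transpose a b

  permSum-transposeCols : ∀ {r} (F : Fin r → Fin r → Carrier) {a b : Fin r} {c : Carrier} →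
    (∀ k → F k a ≈ c ∙ F k b) → (σ : Permutation′ r) →
    permSum F (σ ∘ₚ Perm.transpose a b) ≈ permSum F σ
  permSum-transposeCols F {a} {b} col σ = begin
    permSum F (σ ∘ₚ Perm.transpose a b)              ≈⟨ permSum-inverse (λ k j → F k (PC.transpose a b j)) σ ⟨
    sum (λ j → F (σ ⟨$⟩ˡ j) (PC.transpose a b j))    ≈⟨ sum-transposeRows (λ j k → F k j) col (σ ⟨$⟩ˡ_) ⟩
    sum (λ j → F (σ ⟨$⟩ˡ j) j)                       ≈⟨ permSum-inverse F σ ⟩
    permSum F σ                                     ∎

insert-cong : ∀ {m} (i j : Fin (suc m)) {π ρ : Permutation′ m} → π ≈ₚ ρ → insert i j π ≈ₚ insert i j ρ
insert-cong i j π≈ρ k with i ≟ k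
... | yes _ = refl
... | no i≢k = cong (punchIn j) (π≈ρ (punchOut i≢k))

module Minimum {c ℓ₁ ℓ₂} (T : TotalPreorder c ℓ₁ ℓ₂) where
  open TotalPreorder T using (Carrier; _≈_; _≲_; total; reflexive) renaming (refl to ≲-refl; trans to ≲-trans)

  argmin-Fin : ∀ {r} (h : Fin (suc r) → Carrier) → ∃[ j ] ∀ i → h j ≲ h i
  argmin-Fin {zero} h = zero , λ { zero → ≲-refl }
  argmin-Fin {suc r} h with argmin-Fin (h ∘ suc)
  ... | j , hj≲ with total (h zero) (h (suc j))
  ...   | inj₁ h0≲hj = zero , λ { zero → ≲-refl ; (suc i) → ≲-trans h0≲hj (hj≲ i) }
  ...   | inj₂ hj≲h0 = suc j , λ { zero → hj≲h0 ; (suc i) → hj≲ i }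

  argmin-Permutation : ∀ r (f : Permutation′ r → Carrier) → (∀ {π ρ} → π ≈ₚ ρ → f π ≈ f ρ) →
    ∃[ σ ] ∀ π → f σ ≲ f π
  argmin-Permutation zero f f-cong = Perm.id , λ π → reflexive (f-cong (λ ()))
  argmin-Permutation (suc r) f f-cong = extend first (best first) , minimal
    where
    extend : Fin (suc r) → Permutation′ r → Permutation′ (suc r)
    extend j = insert zero j

    restricted : ∀ j → ∃[ σ ] ∀ π → f (extend j σ) ≲ f (extend j π)
    restricted j = argmin-Permutation r (f ∘ extend j) (f-cong ∘ insert-cong zero j)

    best : Fin (suc r) → Permutation′ r
    best j = proj₁ (restricted j)

    first : Fin (suc r)
    first = proj₁ (argmin-Fin (λ j → f (extend j (best j))))

    first-minimal : ∀ j → f (extend first (best first)) ≲ f (extend j (best j))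
    first-minimal = proj₂ (argmin-Fin (λ j → f (extend j (best j))))

    minimal : ∀ π → f (extend first (best first)) ≲ f π
    minimal π = ≲-trans (first-minimal (π ⟨$⟩ʳ zero))
                (≲-trans (proj₂ (restricted (π ⟨$⟩ʳ zero)) (remove zero π))
                         (reflexive (f-cong (insert-remove zero π))))

module Multiplicity {a b} {A : Set a} {B : Set b} (_≟B_ : DecidableEquality B) where
  open import Data.Nat using (_≤_; _<_; z≤n; s≤s)
  open import Data.Nat.Properties using (m≤n⇒m≤1+n; <-irrefl)

  multiplicity : B → List B → ℕ
  multiplicity p = length ∘ filter (_≟B p)

  multiplicity-↭ : (p : B) {xs ys : List B} → xs ↭ ys → multiplicity p xs ≡ multiplicity p ys
  multiplicity-↭ p = ↭-length ∘ filter-↭ (_≟B p)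

  module _ {f g : A → B} {p : B} (g→f : ∀ x → g x ≡ p → f x ≡ p) where

    multiplicity-map-≤ : ∀ xs → multiplicity p (map g xs) ≤ multiplicity p (map f xs)
    multiplicity-map-≤ [] = z≤n
    multiplicity-map-≤ (x ∷ xs) with g x ≟B p | f x ≟B p
    ... | yes _ | yes _ = s≤s (multiplicity-map-≤ xs)
    ... | yes gx≡p | no fx≢p = contradiction (g→f x gx≡p) fx≢p
    ... | no _ | yes _ = m≤n⇒m≤1+n (multiplicity-map-≤ xs)
    ... | no _ | no _ = multiplicity-map-≤ xs

    multiplicity-map-< : ∀ {x xs} → x ∈ xs → f x ≡ p → g x ≢ p →
      multiplicity p (map g xs) < multiplicity p (map f xs)
    multiplicity-map-< {xs = y ∷ ys} (here refl) fx≡p gx≢p with g y ≟B p | f y ≟B p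
    ... | yes gy≡p | _ = contradiction gy≡p gx≢p
    ... | no _ | yes _ = s≤s (multiplicity-map-≤ ys)
    ... | no _ | no fy≢p = contradiction fx≡p fy≢p
    multiplicity-map-< {xs = y ∷ ys} (there x∈ys) fx≡p gx≢p with g y ≟B p | f y ≟B p
    ... | yes _ | yes _ = s≤s (multiplicity-map-< x∈ys fx≡p gx≢p)
    ... | yes gy≡p | no fy≢p = contradiction (g→f y gy≡p) fy≢p
    ... | no _ | yes _ = m≤n⇒m≤1+n (multiplicity-map-< x∈ys fx≡p gx≢p)
    ... | no _ | no _ = multiplicity-map-< x∈ys fx≡p gx≢p

  map-≁-multiplicity : (f g : A → B) {x : A} {xs : List A} → x ∈ xs →
    (∀ y → g y ≡ f x → f y ≡ f x) → g x ≢ f x → ¬ (map f xs ↭ map g xs)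
  map-≁-multiplicity f g {x} x∈xs g→f gx≢fx f↭g =
    <-irrefl (sym (multiplicity-↭ (f x) f↭g)) (multiplicity-map-< g→f x∈xs refl gx≢fx)

module _ {n : ℕ} where

  upair-inj : (i j k l : Fin n) → upair i j ≡ upair k l → (i ≡ k × j ≡ l) ⊎ (i ≡ l × j ≡ k)
  upair-inj i j k l eq with i ≤? j | k ≤? l
  upair-inj i j k l refl | yes _ | yes _ = inj₁ (refl , refl)
  upair-inj i j k l refl | yes _ | no _ = inj₂ (refl , refl)
  upair-inj i j k l refl | no _ | yes _ = inj₂ (refl , refl)
  upair-inj i j k l refl | no _ | no _ = inj₁ (refl , refl)

  upair-injˡ : {i k j : Fin n} → upair i j ≡ upair k j → i ≡ k
  upair-injˡ {i} {k} {j} eq with upair-inj i j k j eq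
  ... | inj₁ (i≡k , _) = i≡k
  ... | inj₂ (i≡j , j≡k) = trans i≡j j≡k

  upair-injʳ : {i j l : Fin n} → upair i j ≡ upair i l → j ≡ l
  upair-injʳ {i} {j} {l} eq with upair-inj i j i l eq
  ... | inj₁ (_ , j≡l) = j≡l
  ... | inj₂ (i≡l , j≡i) = trans j≡i i≡l

module _ {n r : ℕ} (rows cols : Fin r → Fin n) where

  monomial-cong : {σ τ : Permutation′ r} → σ ≈ₚ τ → monomial rows cols σ ≡ monomial rows cols τ
  monomial-cong σ≈τ = map-cong (λ k → cong (upair (rows k) ∘ cols) (σ≈τ k)) (allFin r)

  -- The pair {rows a, cols (σ a)} occurs strictly less often after the transposition.
  monomial-≁-transposeRows : Injective _≡_ _≡_ rows → Injective _≡_ _≡_ cols →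
    (σ : Permutation′ r) {a b : Fin r} → a ≢ b →
    ¬ (monomial rows cols σ ↭ monomial rows cols (Perm.transpose a b ∘ₚ σ))
  monomial-≁-transposeRows rows-inj cols-inj σ {a} {b} a≢b =
    map-≁-multiplicity (λ k → pair k k) (λ k → pair k (t k)) (∈-allFin a) onlyAt-a differs-at-a
    where
    open Multiplicity (≡-dec _≟_ _≟_)

    t : Fin r → Fin r
    t = PC.transpose a b

    pair : Fin r → Fin r → Fin n × Fin n
    pair k l = upair (rows k) (cols (σ ⟨$⟩ʳ l))

    σ-inj : Injective _≡_ _≡_ (σ ⟨$⟩ʳ_)
    σ-inj = Injection.injective (↔⇒↣ σ)

    differs-at-a : pair a (t a) ≢ pair a a
    differs-at-a eq = a≢b (sym (trans (sym (transpose-matchˡ a b)) (σ-inj (cols-inj (upair-injʳ eq)))))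

    onlyAt-a : ∀ k → pair k (t k) ≡ pair a a → pair k k ≡ pair a a
    onlyAt-a k = cases (k ≟ a) (k ≟ b)
      where
      cases : Dec (k ≡ a) → Dec (k ≡ b) → pair k (t k) ≡ pair a a → pair k k ≡ pair a a
      cases (yes refl) _ _ = refl
      cases (no _) (yes refl) eq =
        contradiction (rows-inj (upair-injˡ (trans (cong (pair b) (sym (transpose-matchʳ a b))) eq))) (a≢b ∘ sym)
      cases (no k≢a) (no k≢b) eq = trans (cong (pair k) (sym (transpose-other k≢a k≢b))) eq

  monomial-≁-transposeCols : Injective _≡_ _≡_ rows → Injective _≡_ _≡_ cols →
    (σ : Permutation′ r) {a b : Fin r} → a ≢ b →
    ¬ (monomial rows cols σ ↭ monomial rows cols (σ ∘ₚ Perm.transpose a b))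
  monomial-≁-transposeCols rows-inj cols-inj σ {a} {b} a≢b σ↭τ =
    monomial-≁-transposeRows rows-inj cols-inj σ {σ ⟨$⟩ˡ a} {σ ⟨$⟩ˡ b}
      (λ eq → a≢b (Injection.injective (↔⇒↣ (Perm.flip σ)) eq))
      (↭-trans σ↭τ (↭-reflexive (monomial-cong {σ ∘ₚ Perm.transpose a b} {τ} (transpose-conjugate σ a b))))
    where
    τ : Permutation′ r
    τ = Perm.transpose (σ ⟨$⟩ˡ a) (σ ⟨$⟩ˡ b) ∘ₚ σ

module _ (G : OrderedAbGroup) where
  open OrderedAbGroup G
  open IsAbelianGroup isAbelianGroup using (isCommutativeMonoid)

  +-commutativeMonoid : CommutativeMonoid 0ℓ 0ℓ
  +-commutativeMonoid = record
    { Carrier = Carrier ; _≈_ = _≡_ ; _∙_ = _+_ ; ε = 0# ; isCommutativeMonoid = isCommutativeMonoid }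

  ≤-totalPreorder : TotalPreorder 0ℓ 0ℓ 0ℓ
  ≤-totalPreorder = record
    { Carrier = Carrier ; _≈_ = _≡_ ; _≲_ = _≤_ ; isTotalPreorder = IsTotalOrder.isTotalPreorder isTotalOrder }

  open PermutationSum +-commutativeMonoid
  open import Algebra.Properties.CommutativeMonoid.Sum +-commutativeMonoid using (sum)

  sumG-tabulate : ∀ {r} (f : Fin r → Carrier) → sumG G (tabulate f) ≡ sum f
  sumG-tabulate {zero} f = refl
  sumG-tabulate {suc r} f = cong (f zero +_) (sumG-tabulate (f ∘ suc))

  module _ {n r : ℕ} (M : Matrix G n) (S : Submatrix G n r) where

    value≡permSum : ∀ σ → value G M S σ ≡ permSum (entry G M S) σ
    value≡permSum σ = trans (cong (sumG G) (map-tabulate id term)) (sumG-tabulate term)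
      where
      term : Fin r → Carrier
      term k = entry G M S k (σ ⟨$⟩ʳ k)

    value-cong : {σ τ : Permutation′ r} → σ ≈ₚ τ → value G M S σ ≡ value G M S τ
    value-cong {σ} {τ} σ≈τ =
      trans (value≡permSum σ) (trans (permSum-cong (entry G M S) {σ} {τ} σ≈τ) (sym (value≡permSum τ)))

    value-minimiser : ∃[ σ ] ∀ π → value G M S σ ≤ value G M S π
    value-minimiser = Minimum.argmin-Permutation ≤-totalPreorder r (value G M S) (λ {π} {ρ} → value-cong {π} {ρ})

    value-transposeRows : ∀ {a b c} → (∀ k → entry G M S a k ≡ c + entry G M S b k) →
      ∀ σ → value G M S (Perm.transpose a b ∘ₚ σ) ≡ value G M S σ
    value-transposeRows {a} {b} row σ = begin
      value G M S (Perm.transpose a b ∘ₚ σ)           ≡⟨ value≡permSum (Perm.transpose a b ∘ₚ σ) ⟩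
      permSum (entry G M S) (Perm.transpose a b ∘ₚ σ) ≡⟨ permSum-transposeRows (entry G M S) row σ ⟩
      permSum (entry G M S) σ                         ≡⟨ value≡permSum σ ⟨
      value G M S σ                                   ∎
      where open ≡-Reasoning

    value-transposeCols : ∀ {a b c} → (∀ k → entry G M S k a ≡ c + entry G M S k b) →
      ∀ σ → value G M S (σ ∘ₚ Perm.transpose a b) ≡ value G M S σ
    value-transposeCols {a} {b} col σ = begin
      value G M S (σ ∘ₚ Perm.transpose a b)           ≡⟨ value≡permSum (σ ∘ₚ Perm.transpose a b) ⟩
      permSum (entry G M S) (σ ∘ₚ Perm.transpose a b) ≡⟨ permSum-transposeCols (entry G M S) col σ ⟩
      permSum (entry G M S) σ                         ≡⟨ value≡permSum σ ⟨
      value G M S σ                                   ∎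
      where open ≡-Reasoning

-- The argument does not use the symmetry of M.
proposition4 : (G : OrderedAbGroup) (n r : ℕ) (M : Matrix G n) → Symmetric G M →
    (S : Submatrix G n r) →
    (∃[ a ] ∃[ b ] (a ≢ b × RowTropMultiple G M S a b))
      ⊎ (∃[ a ] ∃[ b ] (a ≢ b × ColTropMultiple G M S a b)) →
    SymTropSingular G M S
proposition4 G n r M _ S multiple with value-minimiser G M S | multiple
... | σ , σ-minimal | inj₁ (a , b , a≢b , c , row) =
  σ , Perm.transpose a b ∘ₚ σ ,
  monomial-≁-transposeRows (rows S) (cols S) (rowsInj S) (colsInj S) σ a≢b ,
  sym (value-transposeRows G M S row σ) , σ-minimal
... | σ , σ-minimal | inj₂ (a , b , a≢b , c , col) =
  σ , σ ∘ₚ Perm.transpose a b ,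
  monomial-≁-transposeCols (rows S) (cols S) (rowsInj S) (colsInj S) σ a≢b ,
  sym (value-transposeCols G M S col σ) , σ-minimal
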